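{- Let $k$ be a positive integer. If $G$ is a half $k$-tree, then $\chi_o(G)\le 2k+1$.
   Context: All graphs are finite, simple and undirected; $\chi$ is the ordinary chromatic number. For a positive integer $k$, a connected graph $G$ is a half $k$-tree if it can be built as follows: start from a connected graph $H$ on $p$ vertices, where $2\le p\le k+1$ and $\chi(H)\ge\lfloor p/2\rfloor+1$; then repeatedly add a new vertex $v$ adjacent to at most $k$ vertices of the current graph, in such a way that the subgraph of the current graph induced by the neighborhood $N(v)$ satisfies $\chi(G[N(v)])\ge\lfloor d(v)/2\rfloor+1$, where $d(v)$ is the degree of $v$. A proper vertex coloring $\varphi$ of a graph $G$ is called an odd coloring if for every non-isolated vertex $x$ of $G$ there is a color $c$ such that the number of neighbors $y\in N(x)$ with $\varphi(y)=c$ is odd. The odd chromatic number $\chi_o(G)$ is the minimum number of colors in an odd coloring of $G$. -}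

module Defs where

open import Data.Nat using (ℕ; zero; suc; _+_; _*_; _≤_; _<_; _<ᵇ_)
open import Data.Nat.DivMod using (_/_; _%_)
open import Data.Bool using (Bool; true; false; _∧_)
open import Data.Fin using (Fin; toℕ)
open import Data.Fin.Permutation using (Permutation′; _⟨$⟩ʳ_)
open import Data.List using (List; []; _∷_; length; filter)
open import Data.List.Base using ()
open import Data.Fin.Base using ()
open import Data.Product using (Σ; ∃; ∃-syntax; _×_; _,_)
open import Relation.Nullary using (¬_; Dec; does)
open import Relation.Binary.PropositionalEquality using (_≡_; _≢_)
open import Data.Fin using (_≟_)
open import Data.List using (allFin)
open import Relation.Nullary.Decidable using (⌊_⌋)
open import Data.Bool.Properties using (T?)

record Graph (n : ℕ) : Set where
  field
    adj    : Fin n → Fin n → Bool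
    sym    : ∀ u v → adj u v ≡ adj v u
    irrefl : ∀ v → adj v v ≡ false
open Graph public

count : ∀ {n} → (Fin n → Bool) → ℕ
count {n} P = length (filter (λ u → T? (P u)) (allFin n))

deg : ∀ {n} → Graph n → Fin n → ℕ
deg G x = count (adj G x)

data WalkIn {n : ℕ} (G : Graph n) (S : Fin n → Bool) : Fin n → Fin n → Set where
  here  : ∀ {u} → S u ≡ true → WalkIn G S u u
  step  : ∀ {u v w} → S u ≡ true → adj G u v ≡ true → WalkIn G S v w → WalkIn G S u w

ConnectedIn : ∀ {n} → Graph n → (Fin n → Bool) → Set
ConnectedIn {n} G S =
  (∃[ u ] S u ≡ true) × (∀ u v → S u ≡ true → S v ≡ true → WalkIn G S u v)

allV : ∀ {n} → Fin n → Bool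
allV _ = true

Connected : ∀ {n} → Graph n → Set
Connected G = ConnectedIn G allV

ColorableIn : ∀ {n} → Graph n → (Fin n → Bool) → ℕ → Set
ColorableIn {n} G S m =
  Σ ((u : Fin n) → S u ≡ true → Fin m) λ c →
    ∀ u v (su : S u ≡ true) (sv : S v ≡ true) → adj G u v ≡ true → c u su ≢ c v sv

χIn≥1+ : ∀ {n} → Graph n → (Fin n → Bool) → ℕ → Set
χIn≥1+ G S m = ¬ ColorableIn G S m

-- The construction order is recorded by a permutation σ:
-- the vertex v is the (toℕ (σ v))-th vertex added (0-based); the first p vertices
-- form the starting graph H, and each later vertex v is joined to its neighbours
-- of smaller rank (its neighbourhood at the time it was added).
HalfKTree : ∀ {n} → ℕ → Graph n → Set
HalfKTree {n} k G =
  Connected G ×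
  Σ ℕ λ p → Σ (Permutation′ n) λ σ →
    let rank : Fin n → ℕ
        rank v = toℕ (σ ⟨$⟩ʳ v)
        inH : Fin n → Bool
        inH v = rank v <ᵇ p
        before : Fin n → Fin n → Bool
        before v u = adj G v u ∧ (rank u <ᵇ rank v)
    in (2 ≤ p) × (p ≤ k + 1) × (p ≤ n) ×
       ConnectedIn G inH ×
       χIn≥1+ G inH (p / 2) ×
       (∀ v → p ≤ rank v →
          (count (before v) ≤ k) ×
          χIn≥1+ G (before v) (count (before v) / 2))

nbrsColored : ∀ {n m} → Graph n → (Fin n → Fin m) → Fin n → Fin m → ℕ
nbrsColored G c x col = count (λ y → adj G x y ∧ ⌊ c y ≟ col ⌋)

OddColoring : ∀ {n} → Graph n → ℕ → Set
OddColoring {n} G m =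
  Σ (Fin n → Fin m) λ c →
    (∀ u v → adj G u v ≡ true → c u ≢ c v) ×
    (∀ x → 0 < deg G x → ∃[ col ] (nbrsColored G c x col % 2 ≡ 1))

χo≤ : ∀ {n} → Graph n → ℕ → Set
χo≤ G m = OddColoring G m

{-# OPTIONS --safe #-}
module Submission where

-- Colour the vertices in construction order, the p vertices of H with distinct colours.
-- Each vertex v also gets a witness colour w v carried by exactly one neighbour of v: for v in H
-- a neighbour inside H (H is connected and p ≥ 2); for a later vertex x a colour occurring exactly
-- once on its earlier neighbourhood N⁻(x), which exists because otherwise every colour class of
-- N⁻(x) has two elements, giving a proper colouring of G[N⁻(x)] with ⌊d(x)/2⌋ colours. The colour
-- of x avoids the colours and witness colours of N⁻(x), at most 2k < 2k + 1 of them, so no later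
-- vertex ever spoils a witness colour.

open import Defs
open import Data.Bool using (Bool; true; _∧_)
open import Data.Bool.Properties using (T?; T-≡)
open import Data.Fin using (Fin; toℕ; fromℕ; fromℕ<; inject₁; inject≤; _≟_)
open import Data.Fin.Permutation using (Permutation′; _⟨$⟩ʳ_; _⟨$⟩ˡ_; inverseˡ; inverseʳ)
open import Data.Fin.Properties
  using (toℕ-fromℕ<; toℕ-injective; toℕ<n; fromℕ≢inject₁; inject₁-injective; inject≤-injective;
         pigeonhole; ¬∀⟶∃¬)
open import Data.List using (List; []; _∷_; length; filter; lookup; map; _++_; allFin)
open import Data.List.Properties using (filter-notAll; length-++; length-map)
open import Data.List.Membership.Propositional using (_∈_; _∉_; lose)
open import Data.List.Membership.Propositional.Properties
  using (∈-filter⁺; ∈-filter⁻; ∈-allFin; ∈-map⁺; ∈-++⁺ˡ; ∈-++⁺ʳ)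
open import Data.List.Relation.Unary.Any as Any using (Any; here; there; index; any?)
open import Data.List.Relation.Unary.Any.Properties using (lookup-index)
open import Data.List.Relation.Unary.All using (_∷_)
open import Data.List.Relation.Unary.AllPairs using (_∷_)
open import Data.List.Relation.Unary.Unique.Propositional using (Unique)
open import Data.List.Relation.Unary.Unique.Propositional.Properties using (allFin⁺; filter⁺)
open import Data.Nat
  using (ℕ; zero; suc; _+_; _*_; _≤_; _<_; _⊔_; _<ᵇ_; _<?_; s≤s; s≤s⁻¹; z≤n; NonZero; >-nonZero)
open import Data.Nat.DivMod using (_/_; _%_; _mod_; m/n≡1+[m∸n]/n; /-monoˡ-≤; m<n⇒m%n≡m)
open import Data.Nat.Properties
  using (≤-refl; ≤-trans; <-trans; <⇒≤; <-≤-trans; <-irrefl; <-cmp; ≮⇒≥; ≤∧≢⇒<; m≤n⇒m<n∨m≡n;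
         +-mono-≤; m≤n+m; m≤m+n; <ᵇ⇒<; <⇒<ᵇ; ⊔-lub; m⊔n≤o⇒m≤o; m⊔n≤o⇒n≤o; m<n⇒m<n⊔o; m<n⇒m<o⊔n;
         m≤n⇒m⊔n≡n; m≥n⇒m⊔n≡m; ≤-reflexive; +-comm; +-identityʳ; +-monoˡ-≤; ≤⇒≯; module ≤-Reasoning)
open import Data.Product using (Σ; ∃₂; ∃-syntax; _×_; _,_; proj₁; proj₂)
open import Data.Sum as Sum using (_⊎_; inj₁; inj₂)
open import Data.Vec.Functional using (updateAt)
open import Data.Vec.Functional.Properties using (updateAt-updates; updateAt-minimal)
open import Function using (_∘_; const; Equivalence)
open import Relation.Binary using (tri<; tri≈; tri>)
open import Relation.Binary.Definitions using (DecidableEquality)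
open import Relation.Nullary using (¬_; Dec; yes; no; ¬?; contradiction)
open import Relation.Nullary.Decidable using (⌊_⌋; toWitness; fromWitness)
open import Relation.Binary.PropositionalEquality as ≡
  using (_≡_; _≢_; refl; trans; cong; cong₂; subst)

length<⇒∃∉ : ∀ {m} (xs : List (Fin m)) → length xs < m → ∃[ a ] a ∉ xs
length<⇒∃∉ {m} xs xs<m = ¬∀⟶∃¬ m (_∈ xs) (λ a → any? (a ≟_) xs) ¬covers
  where
  ¬covers : ¬ (∀ a → a ∈ xs)
  ¬covers covers with pigeonhole xs<m (λ a → index (covers a))
  ... | i , j , i<j , same = <-irrefl (cong toℕ i≡j) i<j
    where
    i≡j : i ≡ j
    i≡j = trans (lookup-index (covers i))
                (trans (cong (lookup xs) same) (≡.sym (lookup-index (covers j))))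

unique-constant⇒length≡1 : ∀ {A : Set} {xs : List A} {y : A} →
  Unique xs → y ∈ xs → (∀ {z} → z ∈ xs → z ≡ y) → length xs ≡ 1
unique-constant⇒length≡1 {xs = _ ∷ []} _ _ _ = refl
unique-constant⇒length≡1 {xs = _ ∷ _ ∷ _} ((x≢x′ ∷ _) ∷ _) _ all≡y =
  contradiction (trans (all≡y (here refl)) (≡.sym (all≡y (there (here refl))))) x≢x′

support : ∀ {n} → (Fin n → Bool) → List (Fin n)
support {n} P = filter (λ u → T? (P u)) (allFin n)

∈-support⁺ : ∀ {n} {P : Fin n → Bool} {u} → P u ≡ true → u ∈ support P
∈-support⁺ {P = P} {u} Pu = ∈-filter⁺ (λ u → T? (P u)) (∈-allFin u) (Equivalence.from T-≡ Pu)

∈-support⁻ : ∀ {n} {P : Fin n → Bool} {u} → u ∈ support P → P u ≡ true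
∈-support⁻ {n} {P} u∈ = Equivalence.to T-≡ (proj₂ (∈-filter⁻ (λ u → T? (P u)) {xs = allFin n} u∈))

count≡1 : ∀ {n} {P : Fin n → Bool} {y : Fin n} →
  P y ≡ true → (∀ z → P z ≡ true → z ≡ y) → count P ≡ 1
count≡1 {n} {P} Py only-y =
  unique-constant⇒length≡1 (filter⁺ (λ u → T? (P u)) {allFin n} (allFin⁺ n))
    (∈-support⁺ Py) (λ z∈ → only-y _ (∈-support⁻ z∈))

m<n⇒1+m/2≤[1+n]/2 : ∀ {m n} → m < n → suc (m / 2) ≤ suc n / 2
m<n⇒1+m/2≤[1+n]/2 {m} {n} m<n =
  subst (_≤ suc n / 2) (m/n≡1+[m∸n]/n {suc (suc m)} (s≤s (s≤s z≤n))) (/-monoˡ-≤ 2 (s≤s m<n))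

module ColourClasses {A B : Set} (_≟B_ : DecidableEquality B) (φ : A → B) where

  SingletonClass : List A → Set
  SingletonClass xs = ∃[ y ] y ∈ xs × (∀ {z} → z ∈ xs → φ z ≡ φ y → z ≡ y)

  RefiningLabelling : List A → ℕ → Set
  RefiningLabelling xs r =
    Σ (∀ y → y ∈ xs → Fin r) λ g →
      ∀ {a b} (a∈ : a ∈ xs) (b∈ : b ∈ xs) → g a a∈ ≡ g b b∈ → φ a ≡ φ b

  RefiningLabelling-weaken : ∀ {xs r r′} → r ≤ r′ → RefiningLabelling xs r → RefiningLabelling xs r′
  RefiningLabelling-weaken r≤r′ (g , refines) =
    (λ y y∈ → inject≤ (g y y∈) r≤r′) ,
    λ a∈ b∈ eq → refines a∈ b∈ (inject≤-injective r≤r′ r≤r′ _ _ eq)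

  module _ (y : A) (ys : List A) where

    others : List A
    others = filter (λ z → ¬? (φ z ≟B φ y)) ys

    ∈-others : ∀ {z} → z ∈ y ∷ ys → φ z ≢ φ y → z ∈ others
    ∈-others (here refl) φz≢φy = contradiction refl φz≢φy
    ∈-others (there z∈) φz≢φy = ∈-filter⁺ (λ z → ¬? (φ z ≟B φ y)) z∈ φz≢φy

    others-shorter : Any (λ z → φ z ≡ φ y) ys → length others < length ys
    others-shorter some = filter-notAll (λ z → ¬? (φ z ≟B φ y)) ys (Any.map (λ eq ne → ne eq) some)

    head-singletonClass : ¬ Any (λ z → φ z ≡ φ y) ys → SingletonClass (y ∷ ys)
    head-singletonClass none = y , here refl , only-y
      where
      only-y : ∀ {z} → z ∈ y ∷ ys → φ z ≡ φ y → z ≡ y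
      only-y (here z≡y) _ = z≡y
      only-y (there z∈) eq = contradiction (lose z∈ eq) none

    singletonClass-others : SingletonClass others → SingletonClass (y ∷ ys)
    singletonClass-others (y₀ , y₀∈ , only-y₀) = y₀ , there (proj₁ y₀∈ys) , only-y₀′
      where
      y₀∈ys = ∈-filter⁻ (λ z → ¬? (φ z ≟B φ y)) y₀∈
      only-y₀′ : ∀ {z} → z ∈ y ∷ ys → φ z ≡ φ y₀ → z ≡ y₀
      only-y₀′ z∈ eq = only-y₀ (∈-others z∈ (λ eq′ → proj₂ y₀∈ys (trans (≡.sym eq) eq′))) eq

    refiningLabelling-others : ∀ {r} →
      RefiningLabelling others r → RefiningLabelling (y ∷ ys) (suc r)
    refiningLabelling-others {r} (g , refines) = g′ , refines′
      where
      g′ : ∀ z → z ∈ y ∷ ys → Fin (suc r)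
      g′ z z∈ with φ z ≟B φ y
      ... | yes _ = fromℕ r
      ... | no ne = inject₁ (g z (∈-others z∈ ne))
      refines′ : ∀ {a b} (a∈ : a ∈ y ∷ ys) (b∈ : b ∈ y ∷ ys) → g′ a a∈ ≡ g′ b b∈ → φ a ≡ φ b
      refines′ {a} {b} a∈ b∈ eq with φ a ≟B φ y | φ b ≟B φ y
      ... | yes φa≡φy | yes φb≡φy = trans φa≡φy (≡.sym φb≡φy)
      ... | yes _ | no _ = contradiction eq fromℕ≢inject₁
      ... | no _ | yes _ = contradiction (≡.sym eq) fromℕ≢inject₁
      ... | no _ | no _ = refines _ _ (inject₁-injective eq)

  -- Unless some colour occurs exactly once, every colour class has two elements,
  -- so there are at most ⌊|xs|/2⌋ classes.
  singletonClass⊎refiningLabelling : ∀ xs → SingletonClass xs ⊎ RefiningLabelling xs (length xs / 2)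
  singletonClass⊎refiningLabelling xs = go (length xs) xs ≤-refl
    where
    go : ∀ b xs → length xs ≤ b → SingletonClass xs ⊎ RefiningLabelling xs (length xs / 2)
    go _ [] _ = inj₂ ((λ _ ()) , λ ())
    go (suc b) (y ∷ ys) (s≤s ys≤b) with any? (λ z → φ z ≟B φ y) ys
    ... | no none = inj₁ (head-singletonClass y ys none)
    ... | yes some =
      Sum.map (singletonClass-others y ys)
              (RefiningLabelling-weaken (m<n⇒1+m/2≤[1+n]/2 shorter) ∘ refiningLabelling-others y ys)
              (go b (others y ys) (≤-trans (<⇒≤ shorter) ys≤b))
      where shorter = others-shorter y ys some

∧≡true⇒ : ∀ {x y} → x ∧ y ≡ true → x ≡ true × y ≡ true
∧≡true⇒ {true} {true} _ = refl , refl

∧≡true⇐ : ∀ {x y} → x ≡ true → y ≡ true → x ∧ y ≡ true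
∧≡true⇐ refl refl = refl

<ᵇ≡true⇒ : ∀ {m n} → (m <ᵇ n) ≡ true → m < n
<ᵇ≡true⇒ {m} {n} m<ᵇn = <ᵇ⇒< m n (Equivalence.from T-≡ m<ᵇn)

<ᵇ≡true⇐ : ∀ {m n} → m < n → (m <ᵇ n) ≡ true
<ᵇ≡true⇐ = Equivalence.to T-≡ ∘ <⇒<ᵇ

⌊⌋≡true⇒ : ∀ {P : Set} {P? : Dec P} → ⌊ P? ⌋ ≡ true → P
⌊⌋≡true⇒ = toWitness ∘ Equivalence.from T-≡

⌊⌋≡true⇐ : ∀ {P : Set} {P? : Dec P} → P → ⌊ P? ⌋ ≡ true
⌊⌋≡true⇐ = Equivalence.to T-≡ ∘ fromWitness

module _ {n} (G : Graph n) where

  adj-sym : ∀ {u v} → adj G u v ≡ true → adj G v u ≡ true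
  adj-sym {u} {v} uv = trans (sym G v u) uv

  adj⇒≢ : ∀ {u v} → adj G u v ≡ true → u ≢ v
  adj⇒≢ {u} uv refl = contradiction (trans (≡.sym uv) (irrefl G u)) λ ()

  walk-start : ∀ {S u v} → WalkIn G S u v → S u ≡ true
  walk-start (here Su) = Su
  walk-start (step Su _ _) = Su

  walk⇒neighbour : ∀ {S u v} → u ≢ v → WalkIn G S u v → ∃[ y ] adj G u y ≡ true × S y ≡ true
  walk⇒neighbour u≢u (here _) = contradiction refl u≢u
  walk⇒neighbour _ (step _ uy walk) = _ , uy , walk-start walk

  connectedIn⇒neighbour : ∀ {S a b} → ConnectedIn G S → S a ≡ true → S b ≡ true → a ≢ b →
    ∀ {u} → S u ≡ true → ∃[ y ] adj G u y ≡ true × S y ≡ true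
  connectedIn⇒neighbour {b = b} (_ , walk) Sa Sb a≢b {u} Su with u ≟ b
  ... | yes refl = walk⇒neighbour (a≢b ∘ ≡.sym) (walk u _ Su Sa)
  ... | no u≢b = walk⇒neighbour u≢b (walk u b Su Sb)

module Ranking {n} (G : Graph n) (σ : Permutation′ n) where

  rank : Fin n → ℕ
  rank v = toℕ (σ ⟨$⟩ʳ v)

  rank<n : ∀ v → rank v < n
  rank<n v = toℕ<n (σ ⟨$⟩ʳ v)

  rank-injective : ∀ {u v} → rank u ≡ rank v → u ≡ v
  rank-injective {u} {v} eq =
    trans (≡.sym (inverseˡ σ)) (trans (cong (σ ⟨$⟩ˡ_) (toℕ-injective eq)) (inverseˡ σ))

  vertexAt : ∀ t → t < n → Fin n
  vertexAt t t<n = σ ⟨$⟩ˡ fromℕ< t<n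

  rank-vertexAt : ∀ {t} (t<n : t < n) → rank (vertexAt t t<n) ≡ t
  rank-vertexAt t<n = trans (cong toℕ (inverseʳ σ)) (toℕ-fromℕ< t<n)

  before : Fin n → Fin n → Bool
  before v u = adj G v u ∧ (rank u <ᵇ rank v)

  Earlier : Fin n → Fin n → Set
  Earlier v u = adj G v u ≡ true × rank u < rank v

  before⇒Earlier : ∀ {v u} → before v u ≡ true → Earlier v u
  before⇒Earlier b with ∧≡true⇒ b
  ... | vu , u<ᵇv = vu , <ᵇ≡true⇒ u<ᵇv

  Earlier⇒before : ∀ {v u} → Earlier v u → before v u ≡ true
  Earlier⇒before (vu , u<v) = ∧≡true⇐ vu (<ᵇ≡true⇐ u<v)

module HalfKTreeColouring {n} (k : ℕ) (G : Graph n) (p : ℕ) (σ : Permutation′ n) where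

  open Ranking G σ

  m : ℕ
  m = 2 * k + 1

  instance
    m-nonZero : NonZero m
    m-nonZero = >-nonZero (m≤n+m 1 (2 * k))

  k+k<m : k + k < m
  k+k<m = ≤-reflexive (trans (+-comm 1 (k + k)) (cong (λ j → k + j + 1) (≡.sym (+-identityʳ k))))

  -- For v in H the early vertices are those of H; for a later v, those added before v.
  Early : Fin n → Fin n → Set
  Early v u = rank u < p ⊔ rank v

  OddWitness : (Fin n → Fin m) → Fin m → Fin n → Fin n → Set
  OddWitness φ c v y =
    adj G v y ≡ true × Early v y × φ y ≡ c ×
    (∀ z → adj G v z ≡ true → Early v z → φ z ≡ c → z ≡ y)

  record Good (φ w : Fin n → Fin m) (v : Fin n) : Set where
    field
      witness : ∃[ y ] OddWitness φ (w v) v y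
      proper  : ∀ {u} → Earlier v u → φ u ≢ φ v
      fresh   : p ≤ rank v → ∀ {u} → Earlier v u → w u ≢ φ v

  GoodBelow : ℕ → (Fin n → Fin m) → (Fin n → Fin m) → Set
  GoodBelow t φ w = ∀ v → rank v < t → Good φ w v

  GoodBelow⇒proper : ∀ {t φ w} → GoodBelow t φ w →
    ∀ {u v} → rank u < t → rank v < t → adj G u v ≡ true → φ u ≢ φ v
  GoodBelow⇒proper good {u} {v} u<t v<t uv with <-cmp (rank u) (rank v)
  ... | tri< u<v _ _ = Good.proper (good v v<t) (adj-sym G uv , u<v)
  ... | tri≈ _ u≡v _ = contradiction (rank-injective u≡v) (adj⇒≢ G uv)
  ... | tri> _ _ v<u = Good.proper (good u u<t) (uv , v<u) ∘ ≡.sym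

  GoodBelow⇒OddColoring : ∀ {φ w} → GoodBelow n φ w → OddColoring G m
  GoodBelow⇒OddColoring {φ} {w} good = φ , proper , odd
    where
    proper : ∀ u v → adj G u v ≡ true → φ u ≢ φ v
    proper u v = GoodBelow⇒proper good (rank<n u) (rank<n v)

    odd : ∀ x → 0 < deg G x → ∃[ c ] nbrsColored G φ x c % 2 ≡ 1
    odd x _ with Good.witness (good x (rank<n x))
    ... | y , xy , _ , φy≡wx , only-early-y =
      w x , cong (_% 2) (count≡1 (∧≡true⇐ xy (⌊⌋≡true⇐ φy≡wx)) only-y)
      where
      only-y : ∀ z → adj G x z ∧ ⌊ φ z ≟ w x ⌋ ≡ true → z ≡ y
      only-y z xz∧φz≡wx with ∧≡true⇒ xz∧φz≡wx | rank z <? p ⊔ rank x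
      ... | xz , φz≡wx | yes early = only-early-y z xz early (⌊⌋≡true⇒ φz≡wx)
      -- a neighbour z that is not early for x is a later vertex with x ∈ N⁻(z)
      ... | xz , φz≡wx | no late =
        contradiction (≡.sym (⌊⌋≡true⇒ φz≡wx))
                      (Good.fresh (good z (rank<n z)) p≤z (adj-sym G xz , x<z))
        where
        p⊔x≤z = ≮⇒≥ late
        p≤z = m⊔n≤o⇒m≤o p (rank x) p⊔x≤z
        x<z = ≤∧≢⇒< (m⊔n≤o⇒n≤o p (rank x) p⊔x≤z) (λ eq → adj⇒≢ G xz (rank-injective eq))

  AgreeBelow : ℕ → (Fin n → Fin m) → (Fin n → Fin m) → Set
  AgreeBelow t f f′ = ∀ u → rank u < t → f u ≡ f′ u

  Good-cong : ∀ {t φ w φ′ w′ v} → p ≤ t → rank v < t →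
    AgreeBelow t φ φ′ → AgreeBelow t w w′ → Good φ w v → Good φ′ w′ v
  Good-cong {t} {φ} {w} {φ′} {w′} {v} p≤t v<t φ≗φ′ w≗w′
    record { witness = y , vy , early-y , φy≡wv , only-y ; proper = proper ; fresh = fresh }
    = record
    { witness = y , vy , early-y , transport φ≗φ′ w≗w′ (early<t early-y) v<t φy≡wv , only-y′
    ; proper  = λ e → proper e ∘ transport (agree-sym φ≗φ′) (agree-sym φ≗φ′) (earlier<t e) v<t
    ; fresh   = λ p≤v e →
                  fresh p≤v e ∘ transport (agree-sym w≗w′) (agree-sym φ≗φ′) (earlier<t e) v<t
    }
    where
    agree-sym : ∀ {f f′} → AgreeBelow t f f′ → AgreeBelow t f′ f
    agree-sym f≗f′ u u<t = ≡.sym (f≗f′ u u<t)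

    transport : ∀ {f f′ g g′ a b} → AgreeBelow t f f′ → AgreeBelow t g g′ →
      rank a < t → rank b < t → f a ≡ g b → f′ a ≡ g′ b
    transport f≗f′ g≗g′ a<t b<t eq = trans (≡.sym (f≗f′ _ a<t)) (trans eq (g≗g′ _ b<t))

    early<t : ∀ {u} → Early v u → rank u < t
    early<t e = <-≤-trans e (⊔-lub p≤t (<⇒≤ v<t))

    earlier<t : ∀ {u} → Earlier v u → rank u < t
    earlier<t (_ , u<v) = <-trans u<v v<t

    only-y′ : ∀ z → adj G v z ≡ true → Early v z → φ′ z ≡ w′ v → z ≡ y
    only-y′ z vz early-z =
      only-y z vz early-z ∘ transport (agree-sym φ≗φ′) (agree-sym w≗w′) (early<t early-z) v<t

  module Construction
    (2≤p : 2 ≤ p) (p≤1+k : p ≤ k + 1) (p≤n : p ≤ n)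
    (H-connected : ConnectedIn G (λ v → rank v <ᵇ p))
    (later : ∀ v → p ≤ rank v → (count (before v) ≤ k) × χIn≥1+ G (before v) (count (before v) / 2))
    where

    φ₀ : Fin n → Fin m
    φ₀ v = rank v mod m

    φ₀-injectiveH : ∀ {u v} → rank u < p → rank v < p → φ₀ u ≡ φ₀ v → u ≡ v
    φ₀-injectiveH u<p v<p eq =
      rank-injective (trans (≡.sym (toℕ-φ₀ u<p)) (trans (cong toℕ eq) (toℕ-φ₀ v<p)))
      where
      p≤m : p ≤ m
      p≤m = ≤-trans p≤1+k (+-monoˡ-≤ 1 (m≤m+n k (k + 0)))
      toℕ-φ₀ : ∀ {v} → rank v < p → toℕ (φ₀ v) ≡ rank v
      toℕ-φ₀ v<p = trans (toℕ-fromℕ< _) (m<n⇒m%n≡m (<-≤-trans v<p p≤m))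

    neighbourInH : ∀ {v} → rank v < p → ∃[ y ] adj G v y ≡ true × rank y < p
    neighbourInH v<p
      with connectedIn⇒neighbour G H-connected
             (inH (rank-vertexAt 0<n) 0<p) (inH (rank-vertexAt 1<n) 2≤p) first≢second (<ᵇ≡true⇐ v<p)
      where
      0<p = ≤-trans (s≤s z≤n) 2≤p
      0<n = ≤-trans 0<p p≤n
      1<n = ≤-trans 2≤p p≤n
      inH : ∀ {v t} → rank v ≡ t → t < p → (rank v <ᵇ p) ≡ true
      inH refl t<p = <ᵇ≡true⇐ t<p
      first≢second : vertexAt 0 0<n ≢ vertexAt 1 1<n
      first≢second eq = contradiction
        (trans (≡.sym (rank-vertexAt 0<n)) (trans (cong rank eq) (rank-vertexAt 1<n))) λ ()
    ... | y , vy , y∈H = y , vy , <ᵇ≡true⇒ y∈H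

    w₀ : Fin n → Fin m
    w₀ v with rank v <? p
    ... | yes v<p = φ₀ (proj₁ (neighbourInH v<p))
    ... | no _ = φ₀ v  -- junk: overwritten when v is added

    w₀-witness : ∀ {v} → rank v < p → ∃[ y ] adj G v y ≡ true × rank y < p × φ₀ y ≡ w₀ v
    w₀-witness {v} v<p with rank v <? p
    ... | yes v<p′ = let y , vy , y<p = neighbourInH v<p′ in y , vy , y<p , refl
    ... | no v≮p = contradiction v<p v≮p

    base : GoodBelow p φ₀ w₀
    base v v<p with w₀-witness v<p
    ... | y , vy , y<p , φ₀y≡w₀v = record
      { witness = y , vy , m<n⇒m<n⊔o (rank v) y<p , φ₀y≡w₀v , only-y
      ; proper  = λ (vu , u<v) →
                    adj⇒≢ G vu ∘ ≡.sym ∘ φ₀-injectiveH (<-trans u<v v<p) v<p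
      ; fresh   = λ p≤v → contradiction v<p (≤⇒≯ p≤v)
      }
      where
      only-y : ∀ z → adj G v z ≡ true → Early v z → φ₀ z ≡ w₀ v → z ≡ y
      only-y z _ early-z φ₀z≡w₀v =
        φ₀-injectiveH (subst (rank z <_) (m≥n⇒m⊔n≡m (<⇒≤ v<p)) early-z) y<p
                      (trans φ₀z≡w₀v (≡.sym φ₀y≡w₀v))

    module Step {t} (p≤t : p ≤ t) (t<n : t < n) {φ w} (good : GoodBelow t φ w) where

      x : Fin n
      x = vertexAt t t<n

      p≤x : p ≤ rank x
      p≤x = subst (p ≤_) (≡.sym (rank-vertexAt t<n)) p≤t

      earlierNeighbours : List (Fin n)
      earlierNeighbours = support (before x)

      ∈earlierNeighbours⁺ : ∀ {u} → Earlier x u → u ∈ earlierNeighbours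
      ∈earlierNeighbours⁺ = ∈-support⁺ ∘ Earlier⇒before

      ∈earlierNeighbours⁻ : ∀ {u} → u ∈ earlierNeighbours → Earlier x u
      ∈earlierNeighbours⁻ = before⇒Earlier ∘ ∈-support⁻

      earlier<t : ∀ {u} → Earlier x u → rank u < t
      earlier<t (_ , u<x) = subst (_ <_) (rank-vertexAt t<n) u<x

      <t⇒≢x : ∀ {u} → rank u < t → u ≢ x
      <t⇒≢x u<t refl = <-irrefl (rank-vertexAt t<n) u<t

      open ColourClasses _≟_ φ

      ¬refiningLabelling : ¬ RefiningLabelling earlierNeighbours (length earlierNeighbours / 2)
      ¬refiningLabelling (g , refines) = proj₂ (later x p≤x) (colouring , proper)
        where
        colouring : ∀ u → before x u ≡ true → Fin (count (before x) / 2)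
        colouring u xu = g u (∈earlierNeighbours⁺ (before⇒Earlier xu))
        proper : ∀ u v (xu : before x u ≡ true) (xv : before x v ≡ true) → adj G u v ≡ true →
          colouring u xu ≢ colouring v xv
        proper u v xu xv uv =
          GoodBelow⇒proper good (earlier<t (before⇒Earlier xu)) (earlier<t (before⇒Earlier xv)) uv
          ∘ refines _ _

      forbidden : List (Fin m)
      forbidden = map φ earlierNeighbours ++ map w earlierNeighbours

      forbidden-short : length forbidden < m
      forbidden-short = begin-strict
        length forbidden
          ≡⟨ length-++ (map φ earlierNeighbours) ⟩
        length (map φ earlierNeighbours) + length (map w earlierNeighbours)
          ≡⟨ cong₂ _+_ (length-map φ earlierNeighbours) (length-map w earlierNeighbours) ⟩
        length earlierNeighbours + length earlierNeighbours
          ≤⟨ +-mono-≤ few few ⟩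
        k + k
          <⟨ k+k<m ⟩
        m ∎
        where
        open ≤-Reasoning
        few = proj₁ (later x p≤x)

      module _ {a} (a∉ : a ∉ forbidden) {y₀} (y₀∈ : y₀ ∈ earlierNeighbours)
               (only-y₀ : ∀ {z} → z ∈ earlierNeighbours → φ z ≡ φ y₀ → z ≡ y₀) where

        φ′ w′ : Fin n → Fin m
        φ′ = updateAt φ x (const a)
        w′ = updateAt w x (const (φ y₀))

        φ≗φ′ : AgreeBelow t φ φ′
        φ≗φ′ u u<t = ≡.sym (updateAt-minimal u x φ (<t⇒≢x u<t))

        w≗w′ : AgreeBelow t w w′
        w≗w′ u u<t = ≡.sym (updateAt-minimal u x w (<t⇒≢x u<t))

        Good-x : Good φ′ w′ x
        Good-x = record
          { witness = y₀ , proj₁ x-y₀ , m<n⇒m<o⊔n p (proj₂ x-y₀) , φ′y₀≡w′x , only-y₀′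
          ; proper  = λ e eq → a∉ (subst (_∈ forbidden) (takes-a φ≗φ′ e eq)
                                     (∈-++⁺ˡ (∈-map⁺ φ (∈earlierNeighbours⁺ e))))
          ; fresh   = λ _ e eq → a∉ (subst (_∈ forbidden) (takes-a w≗w′ e eq)
                                     (∈-++⁺ʳ (map φ earlierNeighbours)
                                             (∈-map⁺ w (∈earlierNeighbours⁺ e))))
          }
          where
          x-y₀ = ∈earlierNeighbours⁻ y₀∈
          φ′y₀≡w′x : φ′ y₀ ≡ w′ x
          φ′y₀≡w′x = trans (≡.sym (φ≗φ′ y₀ (earlier<t x-y₀))) (≡.sym (updateAt-updates x w))
          only-y₀′ : ∀ z → adj G x z ≡ true → Early x z → φ′ z ≡ w′ x → z ≡ y₀
          only-y₀′ z xz early-z φ′z≡w′x =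
            only-y₀ (∈earlierNeighbours⁺ e)
                    (trans (φ≗φ′ z (earlier<t e)) (trans φ′z≡w′x (updateAt-updates x w)))
            where e = xz , subst (rank z <_) (m≤n⇒m⊔n≡n p≤x) early-z
          takes-a : ∀ {f f′ u} → AgreeBelow t f f′ → Earlier x u → f′ u ≡ φ′ x → f u ≡ a
          takes-a f≗f′ e eq = trans (f≗f′ _ (earlier<t e)) (trans eq (updateAt-updates x φ))

        extended : GoodBelow (suc t) φ′ w′
        extended v v<1+t with m≤n⇒m<n∨m≡n (s≤s⁻¹ v<1+t)
        ... | inj₁ v<t = Good-cong p≤t v<t φ≗φ′ w≗w′ (good v v<t)
        ... | inj₂ v≡t =
          subst (Good φ′ w′) (rank-injective (trans (rank-vertexAt t<n) (≡.sym v≡t))) Good-x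

      extend : ∃₂ (GoodBelow (suc t))
      extend with singletonClass⊎refiningLabelling earlierNeighbours
      ... | inj₂ labelling = contradiction labelling ¬refiningLabelling
      ... | inj₁ (y₀ , y₀∈ , only-y₀) =
        _ , _ , extended (proj₂ (length<⇒∃∉ forbidden forbidden-short)) y₀∈ only-y₀

    build : ∀ t → p ≤ t → t ≤ n → ∃₂ (GoodBelow t)
    build zero p≤0 _ = contradiction (≤-trans 2≤p p≤0) λ ()
    build (suc t) p≤1+t 1+t≤n with m≤n⇒m<n∨m≡n p≤1+t
    ... | inj₂ p≡1+t = subst (λ s → ∃₂ (GoodBelow s)) p≡1+t (φ₀ , w₀ , base)
    ... | inj₁ p<1+t with build t (s≤s⁻¹ p<1+t) (<⇒≤ 1+t≤n)
    ...   | _ , _ , good = Step.extend (s≤s⁻¹ p<1+t) 1+t≤n good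

    oddColoring : OddColoring G m
    oddColoring with build n p≤n ≤-refl
    ... | _ , _ , good = GoodBelow⇒OddColoring good

proposition3 : (k : ℕ) → 1 ≤ k → (n : ℕ) (G : Graph n) →
    HalfKTree k G → χo≤ G (2 * k + 1)
proposition3 k _ n G (_ , p , σ , 2≤p , p≤1+k , p≤n , H-connected , _ , later) =
  HalfKTreeColouring.Construction.oddColoring k G p σ 2≤p p≤1+k p≤n H-connected later
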